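{- For every finite graph $G=(V,E)$, $v(G)\le |E|+l(G)+2e(G)$.
   Context: A linear hypergraph is a pair $(P,\mathcal L)$ with $P$ a finite set of points and $\mathcal L$ a set of subsets of $P$ (lines), any two distinct points in at most one line, every line with at least two points; its intersection graph has vertex set $\mathcal L$, distinct lines adjacent iff they intersect. $v(G)$ is the minimum number of points of a linear hypergraph whose intersection graph is isomorphic to $G$. $l(G)$ is the number of vertices of degree $1$ and $e(G)$ the number of isolated vertices of $G$. -}

module Defs where

open import Data.Nat using (ℕ; _+_; _*_; _≤_; _≡ᵇ_; _<ᵇ_)
open import Data.Bool using (Bool; true; false; _∧_)
open import Data.Fin using (Fin; toℕ)
open import Data.Vec using (tabulate)
open import Data.Fin.Subset using (Subset; _∩_; ∣_∣; Nonempty)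
open import Data.Product using (Σ; _×_)
open import Relation.Binary.PropositionalEquality using (_≡_; _≢_)
open import Function.Bundles using (_⇔_)
open import Data.List using (List; map; allFin)
open import Data.Nat.ListAction using (sum)

record Graph (n : ℕ) : Set where
  field
    adj    : Fin n → Fin n → Bool
    sym    : ∀ i j → adj i j ≡ adj j i
    irrefl : ∀ i → adj i i ≡ false
open Graph public

degree : ∀ {n} → Graph n → Fin n → ℕ
degree G i = ∣ tabulate (λ j → adj G i j) ∣

numEdges : ∀ {n} → Graph n → ℕ
numEdges {n} G = sum (map (λ i → ∣ tabulate (λ j → adj G i j ∧ (toℕ i <ᵇ toℕ j)) ∣) (allFin n))

numLeaves : ∀ {n} → Graph n → ℕ
numLeaves G = ∣ tabulate (λ i → degree G i ≡ᵇ 1) ∣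

numIsolated : ∀ {n} → Graph n → ℕ
numIsolated G = ∣ tabulate (λ i → degree G i ≡ᵇ 0) ∣

-- A linear hypergraph on the point set Fin m whose lines are indexed by Fin n:
-- every line has at least two points, and two distinct lines share at most
-- one point (equivalently: two distinct points lie on at most one line).
-- These conditions force distinct indices to give distinct lines.
record IsLinearHypergraph {m n : ℕ} (L : Fin n → Subset m) : Set where
  field
    twoPoints : ∀ i → 2 ≤ ∣ L i ∣
    linear    : ∀ i j → i ≢ j → ∣ L i ∩ L j ∣ ≤ 1

-- The intersection graph of the line family L is G, with the isomorphism
-- given by the indexing: distinct lines i, j meet iff i, j are adjacent in G.
IntersectionGraphIs : ∀ {m n} → (Fin n → Subset m) → Graph n → Set
IntersectionGraphIs L G = ∀ i j → i ≢ j → (Nonempty (L i ∩ L j) ⇔ (adj G i j ≡ true))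

Realizes : ℕ → ∀ {n} → Graph n → Set
Realizes m {n} G = Σ (Fin n → Subset m) λ L → IsLinearHypergraph L × IntersectionGraphIs L G

{-# OPTIONS --safe #-}
module Submission where

-- One point per edge, with the line of a vertex consisting of the edges at that vertex:
-- two distinct lines then share exactly the point of the edge between them, if any.
-- The line of a vertex of degree d has d points, so a leaf line receives one private
-- point and an isolated line two.  The edge points are built by induction on the
-- vertices: vertex 0 contributes one new point for each of its neighbours, which lies
-- on the line of 0 and on the line of that neighbour.

open import Defs
open import Data.Bool using (Bool; true; false; _∧_)
open import Data.Bool.Properties using (∧-zeroʳ; ∧-identityʳ)
open import Data.Fin using (Fin; zero; suc; toℕ)
open import Data.Fin.Subset
  using (Subset; inside; outside; ⊤; ⊥; ⁅_⁆; _∈_; _⊆_; _∩_; ∣_∣; Nonempty)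
open import Data.Fin.Subset.Properties
  using (∣⊤∣≡n; ∣⊥∣≡0; ∣⁅x⁆∣≡1; x∈⁅y⁆⇒x≡y; p⊆q⇒∣p∣≤∣q∣; nonempty?; Empty-unique;
         ∩-comm; ∩-identityˡ; ∩-zeroˡ; ∩-zeroʳ)
import Data.List as List
import Data.List.Properties as List
open import Data.Nat using (ℕ; zero; suc; _+_; _*_; _≤_; _<_; _<ᵇ_; _≡ᵇ_; z≤n; s≤s)
open import Data.Nat.ListAction using (sum)
open import Data.Nat.Properties using (+-assoc; +-identityʳ; ≤-reflexive)
open import Data.Product using (Σ; _×_; _,_; proj₁; proj₂)
open import Data.Vec using (_∷_; []; _++_; tabulate; lookup)
open import Data.Vec.Properties using (zipWith-++; lookup∘tabulate; tabulate-cong)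
open import Function using (_∘_; id)
open import Function.Bundles using (mk⇔)
open import Relation.Nullary using (yes; no; contradiction)
open import Relation.Binary.PropositionalEquality as ≡
  using (_≡_; _≢_; refl; trans; cong; cong₂; subst; module ≡-Reasoning)
open ≡-Reasoning

iverson : Bool → ℕ
iverson true  = 1
iverson false = 0

iverson≤1 : ∀ b → iverson b ≤ 1
iverson≤1 true  = s≤s z≤n
iverson≤1 false = z≤n

0<iverson⇒true : ∀ {b} → 0 < iverson b → b ≡ true
0<iverson⇒true {true} _ = refl

true⇒0<iverson : ∀ {b} → b ≡ true → 0 < iverson b
true⇒0<iverson refl = s≤s z≤n

∣x∷p∣ : ∀ {n} x (p : Subset n) → ∣ x ∷ p ∣ ≡ iverson x + ∣ p ∣
∣x∷p∣ inside  p = refl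
∣x∷p∣ outside p = refl

∣p++q∣ : ∀ {m n} (p : Subset m) (q : Subset n) → ∣ p ++ q ∣ ≡ ∣ p ∣ + ∣ q ∣
∣p++q∣ []            q = refl
∣p++q∣ (inside  ∷ p) q = cong suc (∣p++q∣ p q)
∣p++q∣ (outside ∷ p) q = ∣p++q∣ p q

∣p++q∩p′++q′∣ : ∀ {m n} (p p′ : Subset m) (q q′ : Subset n) →
                ∣ (p ++ q) ∩ (p′ ++ q′) ∣ ≡ ∣ p ∩ p′ ∣ + ∣ q ∩ q′ ∣
∣p++q∩p′++q′∣ p p′ q q′ =
  trans (cong ∣_∣ (zipWith-++ _∧_ p q p′ q′)) (∣p++q∣ (p ∩ p′) (q ∩ q′))

nonempty⇒∣p∣>0 : ∀ {n} {p : Subset n} → Nonempty p → 0 < ∣ p ∣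
nonempty⇒∣p∣>0 {p = p} (x , x∈p) = subst (_≤ ∣ p ∣) (∣⁅x⁆∣≡1 x) (p⊆q⇒∣p∣≤∣q∣ ⁅x⁆⊆p)
  where
  ⁅x⁆⊆p : ⁅ x ⁆ ⊆ p
  ⁅x⁆⊆p y∈⁅x⁆ = subst (_∈ p) (≡.sym (x∈⁅y⁆⇒x≡y x y∈⁅x⁆)) x∈p

∣p∣>0⇒nonempty : ∀ {n} {p : Subset n} → 0 < ∣ p ∣ → Nonempty p
∣p∣>0⇒nonempty {n} {p} ∣p∣>0 with nonempty? p
... | yes nonempty = nonempty
... | no  empty    =
  contradiction (subst (0 <_) (trans (cong ∣_∣ (Empty-unique empty)) (∣⊥∣≡0 n)) ∣p∣>0) λ ()

-- The points of N renumbered as Fin ∣ N ∣: singletonIn N i is {i} if i ∈ N, and ∅ otherwise.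
singletonIn : ∀ {n} (N : Subset n) → Fin n → Subset ∣ N ∣
singletonIn (inside  ∷ N) zero    = inside ∷ ⊥
singletonIn (inside  ∷ N) (suc i) = outside ∷ singletonIn N i
singletonIn (outside ∷ N) zero    = ⊥
singletonIn (outside ∷ N) (suc i) = singletonIn N i

∣singletonIn∣ : ∀ {n} (N : Subset n) i → ∣ singletonIn N i ∣ ≡ iverson (lookup N i)
∣singletonIn∣ (inside  ∷ N) zero    = cong suc (∣⊥∣≡0 ∣ N ∣)
∣singletonIn∣ (inside  ∷ N) (suc i) = ∣singletonIn∣ N i
∣singletonIn∣ (outside ∷ N) zero    = ∣⊥∣≡0 ∣ N ∣
∣singletonIn∣ (outside ∷ N) (suc i) = ∣singletonIn∣ N i

∣singletonIn-tabulate∣ : ∀ {n} (f : Fin n → Bool) i →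
                         ∣ singletonIn (tabulate f) i ∣ ≡ iverson (f i)
∣singletonIn-tabulate∣ f i =
  trans (∣singletonIn∣ (tabulate f) i) (cong iverson (lookup∘tabulate f i))

singletonIn-disjoint : ∀ {n} (N : Subset n) {i j} → i ≢ j →
                       singletonIn N i ∩ singletonIn N j ≡ ⊥
singletonIn-disjoint (inside  ∷ N) {zero}  {zero}  0≢0 = contradiction refl 0≢0
singletonIn-disjoint (inside  ∷ N) {zero}  {suc j} _   = cong (outside ∷_) (∩-zeroˡ _)
singletonIn-disjoint (inside  ∷ N) {suc i} {zero}  _   = cong (outside ∷_) (∩-zeroʳ _)
singletonIn-disjoint (inside  ∷ N) {suc i} {suc j} i≢j =
  cong (outside ∷_) (singletonIn-disjoint N (i≢j ∘ cong suc))
singletonIn-disjoint (outside ∷ N) {zero}  {j}     _   = ∩-zeroˡ _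
singletonIn-disjoint (outside ∷ N) {suc i} {zero}  _   = ∩-zeroʳ _
singletonIn-disjoint (outside ∷ N) {suc i} {suc j} i≢j =
  singletonIn-disjoint N (i≢j ∘ cong suc)

∣singletonIn∩singletonIn∣ : ∀ {n} (N : Subset n) {i j} → i ≢ j →
                            ∣ singletonIn N i ∩ singletonIn N j ∣ ≡ 0
∣singletonIn∩singletonIn∣ N i≢j = trans (cong ∣_∣ (singletonIn-disjoint N i≢j)) (∣⊥∣≡0 ∣ N ∣)

realizes-from-counts : ∀ {m n} (G : Graph n) (L : Fin n → Subset m) →
                       (∀ i → 2 ≤ ∣ L i ∣) →
                       (∀ i j → i ≢ j → ∣ L i ∩ L j ∣ ≡ iverson (adj G i j)) →
                       Realizes m G
realizes-from-counts G L long meet =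
  L , record { twoPoints = long ; linear = linear } , intersects
  where
  linear : ∀ i j → i ≢ j → ∣ L i ∩ L j ∣ ≤ 1
  linear i j i≢j = subst (_≤ 1) (≡.sym (meet i j i≢j)) (iverson≤1 (adj G i j))

  intersects : IntersectionGraphIs L G
  intersects i j i≢j = mk⇔
    (λ nonempty → 0<iverson⇒true (subst (0 <_) (meet i j i≢j) (nonempty⇒∣p∣>0 nonempty)))
    (λ adjacent → ∣p∣>0⇒nonempty
                    (subst (0 <_) (≡.sym (meet i j i≢j)) (true⇒0<iverson adjacent)))

tailGraph : ∀ {n} → Graph (suc n) → Graph n
tailGraph G = record
  { adj    = λ a b → adj G (suc a) (suc b)
  ; sym    = λ a b → Graph.sym G (suc a) (suc b)
  ; irrefl = λ a → irrefl G (suc a)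
  }

neighbours₀ : ∀ {n} → Graph (suc n) → Subset n
neighbours₀ G = tabulate (λ b → adj G zero (suc b))

degree-zero : ∀ {n} (G : Graph (suc n)) → degree G zero ≡ ∣ neighbours₀ G ∣
degree-zero G = cong (λ x → ∣ x ∷ neighbours₀ G ∣) (irrefl G zero)

degree-suc : ∀ {n} (G : Graph (suc n)) a →
             degree G (suc a) ≡ iverson (adj G zero (suc a)) + degree (tailGraph G) a
degree-suc G a = begin
  degree G (suc a)
    ≡⟨ ∣x∷p∣ (adj G (suc a) zero) (tabulate (adj (tailGraph G) a)) ⟩
  iverson (adj G (suc a) zero) + degree (tailGraph G) a
    ≡⟨ cong (λ x → iverson x + degree (tailGraph G) a) (Graph.sym G (suc a) zero) ⟩
  iverson (adj G zero (suc a)) + degree (tailGraph G) a ∎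

forwardDegree : ∀ {n} → Graph n → Fin n → ℕ
forwardDegree G a = ∣ tabulate (λ b → adj G a b ∧ (toℕ a <ᵇ toℕ b)) ∣

forwardDegree-zero : ∀ {n} (G : Graph (suc n)) → forwardDegree G zero ≡ ∣ neighbours₀ G ∣
forwardDegree-zero G =
  cong₂ (λ x p → ∣ x ∷ p ∣) (∧-zeroʳ (adj G zero zero))
                           (tabulate-cong (λ b → ∧-identityʳ (adj G zero (suc b))))

forwardDegree-suc : ∀ {n} (G : Graph (suc n)) a →
                    forwardDegree G (suc a) ≡ forwardDegree (tailGraph G) a
forwardDegree-suc G a = cong (λ x → ∣ x ∷ forwardRow ∣) (∧-zeroʳ (adj G (suc a) zero))
  where
  forwardRow = tabulate (λ b → adj (tailGraph G) a b ∧ (toℕ a <ᵇ toℕ b))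

numEdges-suc : ∀ {n} (G : Graph (suc n)) →
               numEdges G ≡ ∣ neighbours₀ G ∣ + numEdges (tailGraph G)
numEdges-suc {n} G = cong₂ _+_ (forwardDegree-zero G) (cong sum remaining)
  where
  remaining : List.map (forwardDegree G) (List.tabulate suc)
            ≡ List.map (forwardDegree (tailGraph G)) (List.allFin n)
  remaining = begin
    List.map (forwardDegree G) (List.tabulate suc)
      ≡⟨ List.map-tabulate suc (forwardDegree G) ⟩
    List.tabulate (forwardDegree G ∘ suc)
      ≡⟨ List.tabulate-cong (forwardDegree-suc G) ⟩
    List.tabulate (forwardDegree (tailGraph G))
      ≡⟨ ≡.sym (List.map-tabulate id (forwardDegree (tailGraph G))) ⟩
    List.map (forwardDegree (tailGraph G)) (List.allFin n) ∎

record IsIncidenceFamily {m n} (G : Graph n) (L : Fin n → Subset m) : Set where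
  field
    ∣line∣≡degree : ∀ i → ∣ L i ∣ ≡ degree G i
    ∣meet∣≡adj    : ∀ i j → i ≢ j → ∣ L i ∩ L j ∣ ≡ iverson (adj G i j)

IncidenceFamily : ∀ {n} → Graph n → ℕ → Set
IncidenceFamily {n} G m = Σ (Fin n → Subset m) (IsIncidenceFamily G)

addVertex₀ : ∀ {m n} (G : Graph (suc n)) →
             IncidenceFamily (tailGraph G) m → IncidenceFamily G (∣ neighbours₀ G ∣ + m)
addVertex₀ {m} {n} G (L , isFamily) =
  lines , record { ∣line∣≡degree = size ; ∣meet∣≡adj = meet }
  where
  open IsIncidenceFamily isFamily
  N = neighbours₀ G

  lines : Fin (suc n) → Subset (∣ N ∣ + m)
  lines zero    = ⊤ {∣ N ∣} ++ ⊥ {m}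
  lines (suc a) = singletonIn N a ++ L a

  size : ∀ i → ∣ lines i ∣ ≡ degree G i
  size zero = begin
    ∣ lines zero ∣
      ≡⟨ ∣p++q∣ (⊤ {∣ N ∣}) (⊥ {m}) ⟩
    ∣ ⊤ {∣ N ∣} ∣ + ∣ ⊥ {m} ∣
      ≡⟨ cong₂ _+_ (∣⊤∣≡n ∣ N ∣) (∣⊥∣≡0 m) ⟩
    ∣ N ∣ + 0
      ≡⟨ +-identityʳ ∣ N ∣ ⟩
    ∣ N ∣
      ≡⟨ ≡.sym (degree-zero G) ⟩
    degree G zero ∎
  size (suc a) = begin
    ∣ singletonIn N a ++ L a ∣
      ≡⟨ ∣p++q∣ (singletonIn N a) (L a) ⟩
    ∣ singletonIn N a ∣ + ∣ L a ∣
      ≡⟨ cong₂ _+_ (∣singletonIn-tabulate∣ (λ b → adj G zero (suc b)) a) (∣line∣≡degree a) ⟩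
    iverson (adj G zero (suc a)) + degree (tailGraph G) a
      ≡⟨ ≡.sym (degree-suc G a) ⟩
    degree G (suc a) ∎

  meet-zero : ∀ b → ∣ lines zero ∩ lines (suc b) ∣ ≡ iverson (adj G zero (suc b))
  meet-zero b = begin
    ∣ lines zero ∩ lines (suc b) ∣
      ≡⟨ ∣p++q∩p′++q′∣ ⊤ (singletonIn N b) (⊥ {m}) (L b) ⟩
    ∣ ⊤ ∩ singletonIn N b ∣ + ∣ ⊥ ∩ L b ∣
      ≡⟨ cong₂ (λ p q → ∣ p ∣ + ∣ q ∣) (∩-identityˡ (singletonIn N b)) (∩-zeroˡ (L b)) ⟩
    ∣ singletonIn N b ∣ + ∣ ⊥ {m} ∣
      ≡⟨ cong₂ _+_ (∣singletonIn-tabulate∣ (λ c → adj G zero (suc c)) b) (∣⊥∣≡0 m) ⟩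
    iverson (adj G zero (suc b)) + 0
      ≡⟨ +-identityʳ _ ⟩
    iverson (adj G zero (suc b)) ∎

  meet : ∀ i j → i ≢ j → ∣ lines i ∩ lines j ∣ ≡ iverson (adj G i j)
  meet zero    zero    0≢0 = contradiction refl 0≢0
  meet zero    (suc b) _   = meet-zero b
  meet (suc a) zero    _   = begin
    ∣ lines (suc a) ∩ lines zero ∣
      ≡⟨ cong ∣_∣ (∩-comm (lines (suc a)) (lines zero)) ⟩
    ∣ lines zero ∩ lines (suc a) ∣
      ≡⟨ meet-zero a ⟩
    iverson (adj G zero (suc a))
      ≡⟨ cong iverson (Graph.sym G zero (suc a)) ⟩
    iverson (adj G (suc a) zero) ∎
  meet (suc a) (suc b) a≢b = begin
    ∣ (singletonIn N a ++ L a) ∩ (singletonIn N b ++ L b) ∣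
      ≡⟨ ∣p++q∩p′++q′∣ (singletonIn N a) (singletonIn N b) (L a) (L b) ⟩
    ∣ singletonIn N a ∩ singletonIn N b ∣ + ∣ L a ∩ L b ∣
      ≡⟨ cong₂ _+_ (∣singletonIn∩singletonIn∣ N a≢b′) (∣meet∣≡adj a b a≢b′) ⟩
    iverson (adj G (suc a) (suc b)) ∎
    where
    a≢b′ : a ≢ b
    a≢b′ = a≢b ∘ cong suc

incidenceFamily : ∀ {n} (G : Graph n) → IncidenceFamily G (numEdges G)
incidenceFamily {zero}  G = (λ ()) , record { ∣line∣≡degree = λ () ; ∣meet∣≡adj = λ () }
incidenceFamily {suc n} G = subst (IncidenceFamily G) (≡.sym (numEdges-suc G))
                                  (addVertex₀ G (incidenceFamily (tailGraph G)))

leaves isolated : ∀ {n} → Graph n → Subset n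
leaves   G = tabulate (λ i → degree G i ≡ᵇ 1)
isolated G = tabulate (λ i → degree G i ≡ᵇ 0)

padding : ℕ → ℕ
padding d = iverson (d ≡ᵇ 1) + (iverson (d ≡ᵇ 0) + iverson (d ≡ᵇ 0))

2≤d+padding : ∀ d → 2 ≤ d + padding d
2≤d+padding zero          = s≤s (s≤s z≤n)
2≤d+padding (suc zero)    = s≤s (s≤s z≤n)
2≤d+padding (suc (suc d)) = s≤s (s≤s z≤n)

isolatedPoints : ∀ {n} (G : Graph n) → Fin n → Subset (numIsolated G + numIsolated G)
isolatedPoints G i = singletonIn (isolated G) i ++ singletonIn (isolated G) i

privatePoints : ∀ {n} (G : Graph n) → Fin n →
                Subset (numLeaves G + (numIsolated G + numIsolated G))
privatePoints G i = singletonIn (leaves G) i ++ isolatedPoints G i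

∣privatePoints∣ : ∀ {n} (G : Graph n) i → ∣ privatePoints G i ∣ ≡ padding (degree G i)
∣privatePoints∣ G i = begin
  ∣ singletonIn (leaves G) i ++ isolatedPoints G i ∣
    ≡⟨ ∣p++q∣ (singletonIn (leaves G) i) (isolatedPoints G i) ⟩
  ∣ singletonIn (leaves G) i ∣ + ∣ isolatedPoints G i ∣
    ≡⟨ cong (∣ singletonIn (leaves G) i ∣ +_) (∣p++q∣ (singletonIn (isolated G) i) _) ⟩
  ∣ singletonIn (leaves G) i ∣ + (∣ singletonIn (isolated G) i ∣ + ∣ singletonIn (isolated G) i ∣)
    ≡⟨ cong₂ (λ l o → l + (o + o)) (∣singletonIn-tabulate∣ (λ j → degree G j ≡ᵇ 1) i)
                                   (∣singletonIn-tabulate∣ (λ j → degree G j ≡ᵇ 0) i) ⟩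
  padding (degree G i) ∎

∣privatePoints∩privatePoints∣ : ∀ {n} (G : Graph n) {i j} → i ≢ j →
                                ∣ privatePoints G i ∩ privatePoints G j ∣ ≡ 0
∣privatePoints∩privatePoints∣ G {i} {j} i≢j = begin
  ∣ privatePoints G i ∩ privatePoints G j ∣
    ≡⟨ ∣p++q∩p′++q′∣ (singletonIn (leaves G) i) (singletonIn (leaves G) j) _ _ ⟩
  ∣ singletonIn (leaves G) i ∩ singletonIn (leaves G) j ∣ + ∣ isolatedPoints G i ∩ isolatedPoints G j ∣
    ≡⟨ cong (∣ singletonIn (leaves G) i ∩ singletonIn (leaves G) j ∣ +_)
           (∣p++q∩p′++q′∣ (singletonIn (isolated G) i) (singletonIn (isolated G) j) _ _) ⟩
  ∣ singletonIn (leaves G) i ∩ singletonIn (leaves G) j ∣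
    + (∣ singletonIn (isolated G) i ∩ singletonIn (isolated G) j ∣
       + ∣ singletonIn (isolated G) i ∩ singletonIn (isolated G) j ∣)
    ≡⟨ cong₂ (λ l o → l + (o + o)) (∣singletonIn∩singletonIn∣ (leaves G) i≢j)
                                   (∣singletonIn∩singletonIn∣ (isolated G) i≢j) ⟩
  0 ∎

realizes-padded : ∀ {n} (G : Graph n) →
                  Realizes (numEdges G + (numLeaves G + (numIsolated G + numIsolated G))) G
realizes-padded G = realizes-from-counts G lines long meet
  where
  E = proj₁ (incidenceFamily G)
  open IsIncidenceFamily (proj₂ (incidenceFamily G))

  lines : Fin _ → Subset (numEdges G + (numLeaves G + (numIsolated G + numIsolated G)))
  lines i = E i ++ privatePoints G i

  long : ∀ i → 2 ≤ ∣ lines i ∣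
  long i = subst (2 ≤_) (≡.sym ∣lines∣) (2≤d+padding (degree G i))
    where
    ∣lines∣ : ∣ lines i ∣ ≡ degree G i + padding (degree G i)
    ∣lines∣ = trans (∣p++q∣ (E i) (privatePoints G i))
                    (cong₂ _+_ (∣line∣≡degree i) (∣privatePoints∣ G i))

  meet : ∀ i j → i ≢ j → ∣ lines i ∩ lines j ∣ ≡ iverson (adj G i j)
  meet i j i≢j = begin
    ∣ lines i ∩ lines j ∣
      ≡⟨ ∣p++q∩p′++q′∣ (E i) (E j) (privatePoints G i) (privatePoints G j) ⟩
    ∣ E i ∩ E j ∣ + ∣ privatePoints G i ∩ privatePoints G j ∣
      ≡⟨ cong₂ _+_ (∣meet∣≡adj i j i≢j) (∣privatePoints∩privatePoints∣ G i≢j) ⟩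
    iverson (adj G i j) + 0
      ≡⟨ +-identityʳ _ ⟩
    iverson (adj G i j) ∎

mainTheorem6 : ∀ {n} (G : Graph n) →
    Σ ℕ λ m → (m ≤ numEdges G + numLeaves G + 2 * numIsolated G) × Realizes m G
mainTheorem6 G = _ , ≤-reflexive pointCount , realizes-padded G
  where
  e = numEdges G
  l = numLeaves G
  i = numIsolated G

  pointCount : e + (l + (i + i)) ≡ e + l + 2 * i
  pointCount = trans (≡.sym (+-assoc e l (i + i)))
                     (cong (λ k → e + l + (i + k)) (≡.sym (+-identityʳ i)))
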